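{- Let $(T,\eta,\mu)$ be a localisable monad on a symmetric monoidal category $\mathcal{C}$ and let $u\leq v$ be central idempotents. Then the functor $\mathcal{C}|_{u\leq v}\colon\mathcal{C}|_v\to\mathcal{C}|_u$ together with the natural transformation $\varphi\colon T|_u\circ\mathcal{C}|_{u\leq v}\Rightarrow\mathcal{C}|_{u\leq v}\circ T|_v$ with components $\varphi_A=T(A)\otimes u$ (the morphism $T(A)\otimes U\to T(A)$ of $\mathcal{C}$, regarded as a morphism $T(A)\to T(A)$ of $\mathcal{C}|_u$) is a (lax) monad morphism from $T|_v$ to $T|_u$.
   Context: Let $\mathcal{C}$ be a symmetric monoidal category with unit $I$, unitors $\lambda,\rho$, associator $\alpha$ (coherence isomorphisms often suppressed). A central idempotent is a morphism $u\colon U\to I$ such that $\rho_U\circ(U\otimes u)=\lambda_U\circ(u\otimes U)\colon U\otimes U\to U$ and this morphism is invertible; $u\leq v$ means $u=v\circ m$ for some $m\colon U\to V$. $\mathcal{C}|_u$ is the category with the objects of $\mathcal{C}$, morphisms $A\to B$ being morphisms $A\otimes U\to B$ of $\mathcal{C}$, composition of $f\colon A\otimes U\to B$, $g\colon B\otimes U\to C$ given by $g\circ(f\otimes U)\circ(A\otimes U\otimes u)^{ -1}$, identity $A\otimes u$. For $u\leq v$ with $u=v\circ m$, $\mathcal{C}|_{u\leq v}\colon\mathcal{C}|_v\to\mathcal{C}|_u$ is $A\mapsto A$, $f\mapsto f\circ(A\otimes m)$. A monad $(T,\eta,\mu)$ on $\mathcal{C}$ is localisable when there are morphisms $\mathrm{st}_{A,U}\colon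 T(A)\otimes U\to T(A\otimes U)$ for each object $A$ and central idempotent $u$ with: $T(\rho_A)\circ\mathrm{st}_{A,I}=\rho_{T(A)}$; $T(\alpha_{A,U,V})\circ\mathrm{st}_{A,U\otimes V}=\mathrm{st}_{A\otimes U,V}\circ(\mathrm{st}_{A,U}\otimes V)\circ\alpha_{TA,U,V}$; $\eta_{A\otimes U}=\mathrm{st}_{A,U}\circ(\eta_A\otimes U)$; $\mu_{A\otimes U}\circ T(\mathrm{st}_{A,U})\circ\mathrm{st}_{T(A),U}=\mathrm{st}_{A,U}\circ(\mu_A\otimes U)$; $\mathrm{st}_{A,V}\circ(T(A)\otimes m)=T(A\otimes m)\circ\mathrm{st}_{A,U}$ whenever $u=v\circ m$; $\mathrm{st}_{B,U}\circ(T(f)\otimes U)=T(f\otimes U)\circ\mathrm{st}_{A,U}$ for all $f\colon A\to B$. Then $T|_u$ denotes the monad on $\mathcal{C}|_u$ with $T|_u(A)=T(A)$, $T|_u(f\colon A\otimes U\to B)=T(f)\circ\mathrm{st}_{A,U}$, unit $\eta_A\otimes u$, multiplication $\mu_A\otimes u$. A (lax) monad morphism from a monad $(S,\eta^S,\mu^S)$ on $\mathcal{A}$ to a monad $(R,\eta^R,\mu^R)$ on $\mathcal{B}$ is a functor $F\colon\mathcal{A}\to\mathcal{B}$ with a natural transformation $\varphi\colon R\circ F\Rightarrow F\circ S$ such that $\varphi\circ\eta^R_F=F\eta^S$ and $F\mu^S\circ\varphi S\circ R\varphi=\varphi\circ\mu^R_F$. -}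

module Defs where

open import Level using (Level; _⊔_; suc)
open import Relation.Binary using (Rel; IsEquivalence)
open import Data.Product using (Σ; _×_; _,_)

-- A symmetric monoidal category with setoid-valued hom-sets.
-- Convention: α⇒ : (A ⊗ B) ⊗ C ⇒ A ⊗ (B ⊗ C); the paper's α_{A,U,V}
-- (which goes A ⊗ (U ⊗ V) → (A ⊗ U) ⊗ V) is our α⇐.
record SymMonCat (o ℓ e : Level) : Set (suc (o ⊔ ℓ ⊔ e)) where
  infixr 9 _∘_
  infixr 10 _⊗₀_ _⊗₁_
  infix 4 _≈_
  field
    Obj : Set o
    _⇒_ : Obj → Obj → Set ℓ
    _≈_ : ∀ {A B} → Rel (A ⇒ B) e
    ≈-equiv : ∀ {A B} → IsEquivalence (_≈_ {A} {B})
    id : ∀ {A} → A ⇒ A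
    _∘_ : ∀ {A B C} → B ⇒ C → A ⇒ B → A ⇒ C
    ∘-resp-≈ : ∀ {A B C} {f h : B ⇒ C} {g i : A ⇒ B} → f ≈ h → g ≈ i → f ∘ g ≈ h ∘ i
    identityˡ : ∀ {A B} {f : A ⇒ B} → id ∘ f ≈ f
    identityʳ : ∀ {A B} {f : A ⇒ B} → f ∘ id ≈ f
    assoc : ∀ {A B C D} {f : A ⇒ B} {g : B ⇒ C} {h : C ⇒ D} → (h ∘ g) ∘ f ≈ h ∘ (g ∘ f)
    _⊗₀_ : Obj → Obj → Obj
    _⊗₁_ : ∀ {A B C D} → A ⇒ B → C ⇒ D → (A ⊗₀ C) ⇒ (B ⊗₀ D)
    ⊗-identity : ∀ {A B} → id {A} ⊗₁ id {B} ≈ id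
    ⊗-homomorphism : ∀ {A B C D E F} {f : B ⇒ C} {g : A ⇒ B} {h : E ⇒ F} {k : D ⇒ E}
                     → (f ∘ g) ⊗₁ (h ∘ k) ≈ (f ⊗₁ h) ∘ (g ⊗₁ k)
    ⊗-resp-≈ : ∀ {A B C D} {f g : A ⇒ B} {h k : C ⇒ D} → f ≈ g → h ≈ k → f ⊗₁ h ≈ g ⊗₁ k
    I : Obj
    λ⇒ : ∀ {A} → (I ⊗₀ A) ⇒ A
    λ⇐ : ∀ {A} → A ⇒ (I ⊗₀ A)
    ρ⇒ : ∀ {A} → (A ⊗₀ I) ⇒ A
    ρ⇐ : ∀ {A} → A ⇒ (A ⊗₀ I)
    α⇒ : ∀ {A B C} → ((A ⊗₀ B) ⊗₀ C) ⇒ (A ⊗₀ (B ⊗₀ C))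
    α⇐ : ∀ {A B C} → (A ⊗₀ (B ⊗₀ C)) ⇒ ((A ⊗₀ B) ⊗₀ C)
    σ : ∀ {A B} → (A ⊗₀ B) ⇒ (B ⊗₀ A)
    λ-isoˡ : ∀ {A} → λ⇐ {A} ∘ λ⇒ ≈ id
    λ-isoʳ : ∀ {A} → λ⇒ {A} ∘ λ⇐ ≈ id
    ρ-isoˡ : ∀ {A} → ρ⇐ {A} ∘ ρ⇒ ≈ id
    ρ-isoʳ : ∀ {A} → ρ⇒ {A} ∘ ρ⇐ ≈ id
    α-isoˡ : ∀ {A B C} → α⇐ {A} {B} {C} ∘ α⇒ ≈ id
    α-isoʳ : ∀ {A B C} → α⇒ {A} {B} {C} ∘ α⇐ ≈ id
    λ-natural : ∀ {A B} {f : A ⇒ B} → λ⇒ ∘ (id ⊗₁ f) ≈ f ∘ λ⇒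
    ρ-natural : ∀ {A B} {f : A ⇒ B} → ρ⇒ ∘ (f ⊗₁ id) ≈ f ∘ ρ⇒
    α-natural : ∀ {A B C D E F} {f : A ⇒ D} {g : B ⇒ E} {h : C ⇒ F}
                → α⇒ ∘ ((f ⊗₁ g) ⊗₁ h) ≈ (f ⊗₁ (g ⊗₁ h)) ∘ α⇒
    σ-natural : ∀ {A B C D} {f : A ⇒ C} {g : B ⇒ D} → σ ∘ (f ⊗₁ g) ≈ (g ⊗₁ f) ∘ σ
    triangle : ∀ {A B} → (id {A} ⊗₁ λ⇒ {B}) ∘ α⇒ ≈ ρ⇒ ⊗₁ id
    pentagon : ∀ {A B C D} → (id {A} ⊗₁ α⇒ {B} {C} {D}) ∘ α⇒ ∘ (α⇒ ⊗₁ id)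
                              ≈ α⇒ ∘ α⇒
    hexagon : ∀ {A B C} → α⇒ {B} {C} {A} ∘ σ ∘ α⇒ ≈ (id ⊗₁ σ) ∘ α⇒ ∘ (σ ⊗₁ id)
    σ-involutive : ∀ {A B} → σ {B} {A} ∘ σ {A} {B} ≈ id

module _ {o ℓ e} (𝒞 : SymMonCat o ℓ e) where
  open SymMonCat 𝒞

  record Monad : Set (o ⊔ ℓ ⊔ e) where
    field
      F₀ : Obj → Obj
      F₁ : ∀ {A B} → A ⇒ B → F₀ A ⇒ F₀ B
      F-identity : ∀ {A} → F₁ (id {A}) ≈ id
      F-homomorphism : ∀ {A B C} {f : A ⇒ B} {g : B ⇒ C} → F₁ (g ∘ f) ≈ F₁ g ∘ F₁ f
      F-resp-≈ : ∀ {A B} {f g : A ⇒ B} → f ≈ g → F₁ f ≈ F₁ g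
      η : ∀ A → A ⇒ F₀ A
      μ : ∀ A → F₀ (F₀ A) ⇒ F₀ A
      η-natural : ∀ {A B} {f : A ⇒ B} → F₁ f ∘ η A ≈ η B ∘ f
      μ-natural : ∀ {A B} {f : A ⇒ B} → F₁ f ∘ μ A ≈ μ B ∘ F₁ (F₁ f)
      μ-assoc : ∀ {A} → μ A ∘ F₁ (μ A) ≈ μ A ∘ μ (F₀ A)
      μ-identityˡ : ∀ {A} → μ A ∘ F₁ (η A) ≈ id
      μ-identityʳ : ∀ {A} → μ A ∘ η (F₀ A) ≈ id

  mult : ∀ {U} → U ⇒ I → (U ⊗₀ U) ⇒ U
  mult u = ρ⇒ ∘ (id ⊗₁ u)

  -- A central idempotent u : U → I (the inverse of U ⊗ u is recorded).
  record CentralIdem : Set (o ⊔ ℓ ⊔ e) where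
    field
      U : Obj
      u : U ⇒ I
      central : ρ⇒ ∘ (id ⊗₁ u) ≈ λ⇒ ∘ (u ⊗₁ id)
      inv : U ⇒ (U ⊗₀ U)
      inv-isoˡ : inv ∘ mult u ≈ id
      inv-isoʳ : mult u ∘ inv ≈ id

  open CentralIdem

  module Restrict (c : CentralIdem) where
    _⇒ᵤ_ : Obj → Obj → Set ℓ
    A ⇒ᵤ B = (A ⊗₀ U c) ⇒ B

    -- (A ⊗ U ⊗ u)⁻¹ : A ⊗ U → (A ⊗ U) ⊗ U
    splitᵤ : ∀ {A} → (A ⊗₀ U c) ⇒ ((A ⊗₀ U c) ⊗₀ U c)
    splitᵤ = α⇐ ∘ (id ⊗₁ inv c)

    _∘ᵤ_ : ∀ {A B C} → B ⇒ᵤ C → A ⇒ᵤ B → A ⇒ᵤ C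
    g ∘ᵤ f = g ∘ (f ⊗₁ id) ∘ splitᵤ

    idᵤ : ∀ {A} → A ⇒ᵤ A
    idᵤ = ρ⇒ ∘ (id ⊗₁ u c)

  -- The functor 𝒞|_{u≤v} : 𝒞|_v → 𝒞|_u on morphisms, for u = v ∘ m.
  restrict≤ : (c d : CentralIdem) → U c ⇒ U d → ∀ {A B}
              → Restrict._⇒ᵤ_ d A B → Restrict._⇒ᵤ_ c A B
  restrict≤ c d m f = f ∘ (id ⊗₁ m)

  -- A localisable monad: a monad with morphisms st_{A,U} : T A ⊗ U → T (A ⊗ U).
  -- st is given for every pair (U , u : U → I); the axioms are only imposed
  -- for central idempotents.
  record Localisable (T : Monad) : Set (o ⊔ ℓ ⊔ e) where
    open Monad T
    field
      st : ∀ A (V : Obj) → V ⇒ I → (F₀ A ⊗₀ V) ⇒ F₀ (A ⊗₀ V)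
      st-unit : ∀ {A} → F₁ ρ⇒ ∘ st A I id ≈ ρ⇒
      st-assoc : ∀ {A} (c d : CentralIdem)
                 → F₁ (α⇐ {A} {U c} {U d}) ∘ st A (U c ⊗₀ U d) (λ⇒ ∘ (u c ⊗₁ u d))
                   ≈ st (A ⊗₀ U c) (U d) (u d) ∘ (st A (U c) (u c) ⊗₁ id) ∘ α⇐
      st-η : ∀ {A} (c : CentralIdem) → η (A ⊗₀ U c) ≈ st A (U c) (u c) ∘ (η A ⊗₁ id)
      st-μ : ∀ {A} (c : CentralIdem)
             → μ (A ⊗₀ U c) ∘ F₁ (st A (U c) (u c)) ∘ st (F₀ A) (U c) (u c)
               ≈ st A (U c) (u c) ∘ (μ A ⊗₁ id)
      st-m : ∀ {A} (c d : CentralIdem) (m : U c ⇒ U d) → u c ≈ u d ∘ m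
             → st A (U d) (u d) ∘ (id ⊗₁ m) ≈ F₁ (id ⊗₁ m) ∘ st A (U c) (u c)
      st-natural : ∀ {A B} (c : CentralIdem) (f : A ⇒ B)
                   → st B (U c) (u c) ∘ (F₁ f ⊗₁ id) ≈ F₁ (f ⊗₁ id) ∘ st A (U c) (u c)

    module Tres (c : CentralIdem) where
      open Restrict c
      T₁ : ∀ {A B} → A ⇒ᵤ B → F₀ A ⇒ᵤ F₀ B
      T₁ {A} f = F₁ f ∘ st A (U c) (u c)
      ηᵤ : ∀ A → A ⇒ᵤ F₀ A
      ηᵤ A = ρ⇒ ∘ (η A ⊗₁ u c)
      μᵤ : ∀ A → F₀ (F₀ A) ⇒ᵤ F₀ A
      μᵤ A = ρ⇒ ∘ (μ A ⊗₁ u c)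

  IsRestrictionMonadMorphism : (T : Monad) (L : Localisable T)
    (c d : CentralIdem) (m : U c ⇒ U d) → Set (o ⊔ ℓ ⊔ e)
  IsRestrictionMonadMorphism T L c d m =
    (∀ {A} → R (V.idᵤ {A}) ≈ Uc.idᵤ)
    ×
    (∀ {A B C} (f : A V.⇒ᵤ B) (g : B V.⇒ᵤ C) → R (g V.∘ᵤ f) ≈ R g Uc.∘ᵤ R f)
    ×
    (∀ {A B} (f : A V.⇒ᵤ B) → φ B Uc.∘ᵤ Tu.T₁ (R f) ≈ R (Tv.T₁ f) Uc.∘ᵤ φ A)
    ×
    (∀ {A} → φ A Uc.∘ᵤ Tu.ηᵤ A ≈ R (Tv.ηᵤ A))
    ×
    (∀ {A} → (R (Tv.μᵤ A) Uc.∘ᵤ φ (F₀ A)) Uc.∘ᵤ Tu.T₁ (φ A) ≈ φ A Uc.∘ᵤ Tu.μᵤ A)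
    where
      open Monad T
      open Localisable L
      module Uc = Restrict c
      module V = Restrict d
      module Tu = Tres c
      module Tv = Tres d
      R : ∀ {A B} → A V.⇒ᵤ B → A Uc.⇒ᵤ B
      R = restrict≤ c d m
      φ : ∀ A → F₀ A Uc.⇒ᵤ F₀ A
      φ A = ρ⇒ ∘ (id ⊗₁ u c)

{-# OPTIONS --safe #-}
-- The comparison map φ_A = T(A) ⊗ u is the identity of T(A) in 𝒞|_u, so the
-- monad-morphism laws amount to 𝒞|_{u≤v} being a functor that commutes strictly
-- with the monad structure.  Since u = v ∘ m, precomposing f ⊗ v with A ⊗ m gives
-- f ⊗ u; hence 𝒞|_{u≤v} preserves identities, units and multiplications.  It
-- commutes with T because st is natural along m, and it preserves composition
-- because m ⊗ m intertwines the inverses of U ⊗ u and V ⊗ v.  The multiplication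
-- law also needs T|_u to preserve identities, which is naturality of st along
-- u ≤ id_I; that id_I is a central idempotent is Kelly's coherence ρ_I = λ_I.
module Submission where

open import Level using (Level)
open import Data.Product using (_,_)
open import Relation.Binary using (Setoid; IsEquivalence)
import Relation.Binary.Reasoning.Setoid as SetoidReasoning
open import Defs

module MonoidalProperties {o ℓ e} (𝒞 : SymMonCat o ℓ e) where
  open SymMonCat 𝒞

  private variable
    A B C U : Obj
    f g h i k r s : A ⇒ B

  hom-setoid : Obj → Obj → Setoid ℓ e
  hom-setoid A B = record { isEquivalence = ≈-equiv {A} {B} }

  module HomReasoning {A B : Obj} = SetoidReasoning (hom-setoid A B)
  module ≈ {A B : Obj} = IsEquivalence (≈-equiv {A} {B})

  infixr 4 refl⟩∘⟨_
  infixl 5 _⟩∘⟨refl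

  refl⟩∘⟨_ : g ≈ i → f ∘ g ≈ f ∘ i
  refl⟩∘⟨ p = ∘-resp-≈ ≈.refl p

  _⟩∘⟨refl : f ≈ h → f ∘ g ≈ h ∘ g
  p ⟩∘⟨refl = ∘-resp-≈ p ≈.refl

  sym-assoc : h ∘ (g ∘ f) ≈ (h ∘ g) ∘ f
  sym-assoc = ≈.sym assoc

  pullʳ : g ∘ f ≈ h → (i ∘ g) ∘ f ≈ i ∘ h
  pullʳ p = ≈.trans assoc (refl⟩∘⟨ p)

  pullˡ : g ∘ f ≈ h → g ∘ (f ∘ i) ≈ h ∘ i
  pullˡ p = ≈.trans sym-assoc (p ⟩∘⟨refl)

  elimʳ : g ≈ id → f ∘ g ≈ f
  elimʳ p = ≈.trans (refl⟩∘⟨ p) identityʳ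

  cancelʳ : g ∘ h ≈ id → (f ∘ g) ∘ h ≈ f
  cancelʳ p = ≈.trans (pullʳ p) identityʳ

  cancelˡ : h ∘ g ≈ id → h ∘ (g ∘ f) ≈ f
  cancelˡ p = ≈.trans (pullˡ p) identityˡ

  retraction⇒mono : r ∘ h ≈ id → h ∘ f ≈ h ∘ g → f ≈ g
  retraction⇒mono iso p = ≈.trans (≈.sym (cancelˡ iso)) (≈.trans (refl⟩∘⟨ p) (cancelˡ iso))

  section⇒epi : h ∘ s ≈ id → f ∘ h ≈ g ∘ h → f ≈ g
  section⇒epi iso p = ≈.trans (≈.sym (cancelʳ iso)) (≈.trans (p ⟩∘⟨refl) (cancelʳ iso))

  conjugate : r ∘ h ≈ id → k ∘ s ≈ id → h ∘ f ≈ g ∘ k → f ∘ s ≈ r ∘ g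
  conjugate {r = r} {h = h} {k = k} {s = s} {f = f} {g = g} isoʰ isoᵏ p = begin
    f ∘ s              ≈⟨ ≈.sym (cancelˡ isoʰ) ⟩
    r ∘ (h ∘ (f ∘ s))  ≈⟨ refl⟩∘⟨ pullˡ p ⟩
    r ∘ ((g ∘ k) ∘ s)  ≈⟨ refl⟩∘⟨ cancelʳ isoᵏ ⟩
    r ∘ g              ∎
    where open HomReasoning

  merge₁ : (f ⊗₁ id {C}) ∘ (g ⊗₁ id) ≈ (f ∘ g) ⊗₁ id
  merge₁ = ≈.sym (≈.trans (⊗-resp-≈ ≈.refl (≈.sym identityˡ)) ⊗-homomorphism)

  merge₂ : (id {C} ⊗₁ f) ∘ (id ⊗₁ g) ≈ id ⊗₁ (f ∘ g)
  merge₂ = ≈.sym (≈.trans (⊗-resp-≈ (≈.sym identityˡ) ≈.refl) ⊗-homomorphism)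

  serialize₁₂ : f ⊗₁ g ≈ (f ⊗₁ id) ∘ (id ⊗₁ g)
  serialize₁₂ = ≈.trans (⊗-resp-≈ (≈.sym identityʳ) (≈.sym identityˡ)) ⊗-homomorphism

  serialize₂₁ : f ⊗₁ g ≈ (id ⊗₁ g) ∘ (f ⊗₁ id)
  serialize₂₁ = ≈.trans (⊗-resp-≈ (≈.sym identityˡ) (≈.sym identityʳ)) ⊗-homomorphism

  -⊗I-faithful : f ⊗₁ id {I} ≈ g ⊗₁ id → f ≈ g
  -⊗I-faithful p = ≈.trans ρ-conjugate (≈.trans ((refl⟩∘⟨ p) ⟩∘⟨refl) (≈.sym ρ-conjugate))
    where
    ρ-conjugate : f ≈ (ρ⇒ ∘ (f ⊗₁ id)) ∘ ρ⇐
    ρ-conjugate = ≈.sym (≈.trans (ρ-natural ⟩∘⟨refl) (cancelʳ ρ-isoʳ))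

  I⊗-faithful : id {I} ⊗₁ f ≈ id ⊗₁ g → f ≈ g
  I⊗-faithful p = ≈.trans λ-conjugate (≈.trans ((refl⟩∘⟨ p) ⟩∘⟨refl) (≈.sym λ-conjugate))
    where
    λ-conjugate : f ≈ (λ⇒ ∘ (id ⊗₁ f)) ∘ λ⇐
    λ-conjugate = ≈.sym (≈.trans (λ-natural ⟩∘⟨refl) (cancelʳ λ-isoʳ))

  α⇐-natural : α⇐ ∘ (f ⊗₁ (g ⊗₁ h)) ≈ ((f ⊗₁ g) ⊗₁ h) ∘ α⇐
  α⇐-natural = ≈.sym (conjugate α-isoˡ α-isoʳ α-natural)

  triangle-α⇐ : (ρ⇒ {A} ⊗₁ id {B}) ∘ α⇐ ≈ id ⊗₁ λ⇒
  triangle-α⇐ = ≈.trans (≈.sym triangle ⟩∘⟨refl) (cancelʳ α-isoʳ)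

  id⊗ρ∘α≈ρ : (id {A} ⊗₁ ρ⇒ {B}) ∘ α⇒ ≈ ρ⇒
  id⊗ρ∘α≈ρ = -⊗I-faithful (retraction⇒mono α-isoˡ (≈.sym (begin
    α⇒ ∘ (ρ⇒ ⊗₁ id)                                        ≈⟨ refl⟩∘⟨ ≈.sym triangle ⟩
    α⇒ ∘ ((id ⊗₁ λ⇒) ∘ α⇒)                                 ≈⟨ refl⟩∘⟨ ⊗-resp-≈ (≈.sym ⊗-identity) ≈.refl ⟩∘⟨refl ⟩
    α⇒ ∘ (((id ⊗₁ id) ⊗₁ λ⇒) ∘ α⇒)                         ≈⟨ pullˡ α-natural ⟩
    ((id ⊗₁ (id ⊗₁ λ⇒)) ∘ α⇒) ∘ α⇒                         ≈⟨ assoc ⟩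
    (id ⊗₁ (id ⊗₁ λ⇒)) ∘ (α⇒ ∘ α⇒)                         ≈⟨ refl⟩∘⟨ ≈.sym pentagon ⟩
    (id ⊗₁ (id ⊗₁ λ⇒)) ∘ ((id ⊗₁ α⇒) ∘ α⇒ ∘ (α⇒ ⊗₁ id))    ≈⟨ pullˡ merge₂ ⟩
    (id ⊗₁ ((id ⊗₁ λ⇒) ∘ α⇒)) ∘ (α⇒ ∘ (α⇒ ⊗₁ id))          ≈⟨ ⊗-resp-≈ ≈.refl triangle ⟩∘⟨refl ⟩
    (id ⊗₁ (ρ⇒ ⊗₁ id)) ∘ (α⇒ ∘ (α⇒ ⊗₁ id))                 ≈⟨ pullˡ (≈.sym α-natural) ⟩
    (α⇒ ∘ ((id ⊗₁ ρ⇒) ⊗₁ id)) ∘ (α⇒ ⊗₁ id)                 ≈⟨ pullʳ merge₁ ⟩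
    α⇒ ∘ (((id ⊗₁ ρ⇒) ∘ α⇒) ⊗₁ id)                         ∎)))
    where open HomReasoning

  ρ∘α⇐≈id⊗ρ : ρ⇒ ∘ α⇐ ≈ id {A} ⊗₁ ρ⇒ {B}
  ρ∘α⇐≈id⊗ρ = ≈.trans (≈.sym id⊗ρ∘α≈ρ ⟩∘⟨refl) (cancelʳ α-isoʳ)

  ρ-I≈λ-I : ρ⇒ {I} ≈ λ⇒
  ρ-I≈λ-I = I⊗-faithful (section⇒epi α-isoʳ (≈.trans id⊗ρ∘α≈ρ (≈.trans ρ-I⊗I (≈.sym triangle))))
    where
    ρ-I⊗I : ρ⇒ {I ⊗₀ I} ≈ ρ⇒ ⊗₁ id
    ρ-I⊗I = retraction⇒mono ρ-isoˡ (≈.sym ρ-natural)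

  unit-centralIdem : CentralIdem 𝒞
  unit-centralIdem = record
    { U = I
    ; u = id
    ; central = ρ-I≈λ-I ⟩∘⟨refl
    ; inv = ρ⇐
    ; inv-isoˡ = ≈.trans (refl⟩∘⟨ ρ∘id⊗id) ρ-isoˡ
    ; inv-isoʳ = ≈.trans (ρ∘id⊗id ⟩∘⟨refl) ρ-isoʳ
    }
    where
    ρ∘id⊗id : ρ⇒ ∘ (id {I} ⊗₁ id {I}) ≈ ρ⇒
    ρ∘id⊗id = elimʳ ⊗-identity

  absorbʳ : U ⇒ I → (A ⊗₀ U) ⇒ A
  absorbʳ g = ρ⇒ ∘ (id ⊗₁ g)

  absorbˡ : U ⇒ I → (U ⊗₀ A) ⇒ A
  absorbˡ g = λ⇒ ∘ (g ⊗₁ id)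

  ρ∘⊗-∘ʳ : (ρ⇒ ∘ (f ⊗₁ g)) ∘ (id ⊗₁ h) ≈ ρ⇒ ∘ (f ⊗₁ (g ∘ h))
  ρ∘⊗-∘ʳ = pullʳ (≈.trans (≈.sym ⊗-homomorphism) (⊗-resp-≈ identityʳ ≈.refl))

  absorbʳ-natural : (g : U ⇒ I) → absorbʳ g ∘ (f ⊗₁ id) ≈ f ∘ absorbʳ g
  absorbʳ-natural {f = f} g = begin
    (ρ⇒ ∘ (id ⊗₁ g)) ∘ (f ⊗₁ id)   ≈⟨ pullʳ (≈.trans (≈.sym serialize₂₁) serialize₁₂) ⟩
    ρ⇒ ∘ ((f ⊗₁ id) ∘ (id ⊗₁ g))   ≈⟨ pullˡ ρ-natural ⟩
    (f ∘ ρ⇒) ∘ (id ⊗₁ g)           ≈⟨ assoc ⟩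
    f ∘ (ρ⇒ ∘ (id ⊗₁ g))           ∎
    where open HomReasoning

  absorbʳ-α⇐ : (g : U ⇒ I) → absorbʳ g ∘ α⇐ ≈ id {A} ⊗₁ absorbʳ {A = B} g
  absorbʳ-α⇐ g = begin
    (ρ⇒ ∘ (id ⊗₁ g)) ∘ α⇐                ≈⟨ pullʳ (⊗-resp-≈ (≈.sym ⊗-identity) ≈.refl ⟩∘⟨refl) ⟩
    ρ⇒ ∘ (((id ⊗₁ id) ⊗₁ g) ∘ α⇐)        ≈⟨ refl⟩∘⟨ ≈.sym α⇐-natural ⟩
    ρ⇒ ∘ (α⇐ ∘ (id ⊗₁ (id ⊗₁ g)))        ≈⟨ pullˡ ρ∘α⇐≈id⊗ρ ⟩
    (id ⊗₁ ρ⇒) ∘ (id ⊗₁ (id ⊗₁ g))       ≈⟨ merge₂ ⟩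
    id ⊗₁ (ρ⇒ ∘ (id ⊗₁ g))               ∎
    where open HomReasoning

  absorbʳ⊗id-α⇐ : (g : U ⇒ I) → (absorbʳ g ⊗₁ id) ∘ α⇐ ≈ id {A} ⊗₁ absorbˡ {A = B} g
  absorbʳ⊗id-α⇐ g = begin
    ((ρ⇒ ∘ (id ⊗₁ g)) ⊗₁ id) ∘ α⇐        ≈⟨ ≈.sym merge₁ ⟩∘⟨refl ⟩
    ((ρ⇒ ⊗₁ id) ∘ ((id ⊗₁ g) ⊗₁ id)) ∘ α⇐ ≈⟨ pullʳ (≈.sym α⇐-natural) ⟩
    (ρ⇒ ⊗₁ id) ∘ (α⇐ ∘ (id ⊗₁ (g ⊗₁ id))) ≈⟨ pullˡ triangle-α⇐ ⟩
    (id ⊗₁ λ⇒) ∘ (id ⊗₁ (g ⊗₁ id))       ≈⟨ merge₂ ⟩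
    id ⊗₁ (λ⇒ ∘ (g ⊗₁ id))               ∎
    where open HomReasoning

module CentralIdemProperties {o ℓ e} {𝒞 : SymMonCat o ℓ e} (c : CentralIdem 𝒞) where
  open SymMonCat 𝒞
  open MonoidalProperties 𝒞
  open CentralIdem c
  open Restrict 𝒞 c

  private variable
    A B C : Obj

  private
    id⊗mult∘id⊗inv : (id {A} ⊗₁ mult 𝒞 u) ∘ (id ⊗₁ inv) ≈ id
    id⊗mult∘id⊗inv = ≈.trans merge₂ (≈.trans (⊗-resp-≈ ≈.refl inv-isoʳ) ⊗-identity)

  idᵤ∘splitᵤ : idᵤ ∘ splitᵤ {A} ≈ id
  idᵤ∘splitᵤ = ≈.trans (pullˡ (absorbʳ-α⇐ u)) id⊗mult∘id⊗inv

  idᵤ⊗id∘splitᵤ : (idᵤ ⊗₁ id) ∘ splitᵤ {A} ≈ id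
  idᵤ⊗id∘splitᵤ = ≈.trans (pullˡ (≈.trans (absorbʳ⊗id-α⇐ u) (⊗-resp-≈ ≈.refl (≈.sym central))))
                          id⊗mult∘id⊗inv

  ∘ᵤ-identityˡ : {f : A ⇒ᵤ B} → idᵤ ∘ᵤ f ≈ f
  ∘ᵤ-identityˡ = ≈.trans (pullˡ (absorbʳ-natural u)) (cancelʳ idᵤ∘splitᵤ)

  ∘ᵤ-identityʳ : {f : A ⇒ᵤ B} → f ∘ᵤ idᵤ ≈ f
  ∘ᵤ-identityʳ = elimʳ idᵤ⊗id∘splitᵤ

  ∘ᵤ-resp-≈ : {f h : B ⇒ᵤ C} {g i : A ⇒ᵤ B} → f ≈ h → g ≈ i → f ∘ᵤ g ≈ h ∘ᵤ i
  ∘ᵤ-resp-≈ p q = ∘-resp-≈ p (⊗-resp-≈ q ≈.refl ⟩∘⟨refl)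

module RestrictionProperties {o ℓ e} {𝒞 : SymMonCat o ℓ e} (c d : CentralIdem 𝒞)
  (m : SymMonCat._⇒_ 𝒞 (CentralIdem.U c) (CentralIdem.U d))
  (u≈v∘m : SymMonCat._≈_ 𝒞 (CentralIdem.u c) (SymMonCat._∘_ 𝒞 (CentralIdem.u d) m)) where
  open SymMonCat 𝒞
  open MonoidalProperties 𝒞
  open CentralIdem
  module 𝒞ᵤ = Restrict 𝒞 c
  module 𝒞ᵥ = Restrict 𝒞 d

  private variable
    A B C : Obj

  R : A 𝒞ᵥ.⇒ᵤ B → A 𝒞ᵤ.⇒ᵤ B
  R = restrict≤ 𝒞 c d m

  restrict≤-ρ∘⊗ : {f : A ⇒ B} → R (ρ⇒ ∘ (f ⊗₁ u d)) ≈ ρ⇒ ∘ (f ⊗₁ u c)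
  restrict≤-ρ∘⊗ = ≈.trans ρ∘⊗-∘ʳ (refl⟩∘⟨ ⊗-resp-≈ ≈.refl (≈.sym u≈v∘m))

  restrict≤-idᵤ : R (𝒞ᵥ.idᵤ {A}) ≈ 𝒞ᵤ.idᵤ
  restrict≤-idᵤ = restrict≤-ρ∘⊗

  mult-natural : mult 𝒞 (u d) ∘ (m ⊗₁ m) ≈ m ∘ mult 𝒞 (u c)
  mult-natural = begin
    absorbʳ (u d) ∘ (m ⊗₁ m)                ≈⟨ refl⟩∘⟨ serialize₁₂ ⟩
    absorbʳ (u d) ∘ ((m ⊗₁ id) ∘ (id ⊗₁ m)) ≈⟨ pullˡ (absorbʳ-natural (u d)) ⟩
    (m ∘ absorbʳ (u d)) ∘ (id ⊗₁ m)         ≈⟨ pullʳ restrict≤-ρ∘⊗ ⟩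
    m ∘ absorbʳ (u c)                       ∎
    where open HomReasoning

  inv-natural : (m ⊗₁ m) ∘ inv c ≈ inv d ∘ m
  inv-natural = conjugate (inv-isoˡ d) (inv-isoʳ c) mult-natural

  splitᵤ-natural : 𝒞ᵥ.splitᵤ {A} ∘ (id ⊗₁ m) ≈ ((id ⊗₁ m) ⊗₁ m) ∘ 𝒞ᵤ.splitᵤ
  splitᵤ-natural = begin
    (α⇐ ∘ (id ⊗₁ inv d)) ∘ (id ⊗₁ m)       ≈⟨ pullʳ merge₂ ⟩
    α⇐ ∘ (id ⊗₁ (inv d ∘ m))               ≈⟨ refl⟩∘⟨ ⊗-resp-≈ ≈.refl (≈.sym inv-natural) ⟩
    α⇐ ∘ (id ⊗₁ ((m ⊗₁ m) ∘ inv c))        ≈⟨ refl⟩∘⟨ ≈.sym merge₂ ⟩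
    α⇐ ∘ ((id ⊗₁ (m ⊗₁ m)) ∘ (id ⊗₁ inv c)) ≈⟨ pullˡ α⇐-natural ⟩
    (((id ⊗₁ m) ⊗₁ m) ∘ α⇐) ∘ (id ⊗₁ inv c) ≈⟨ assoc ⟩
    ((id ⊗₁ m) ⊗₁ m) ∘ (α⇐ ∘ (id ⊗₁ inv c)) ∎
    where open HomReasoning

  restrict≤-∘ᵤ : (f : A 𝒞ᵥ.⇒ᵤ B) (g : B 𝒞ᵥ.⇒ᵤ C) → R (g 𝒞ᵥ.∘ᵤ f) ≈ R g 𝒞ᵤ.∘ᵤ R f
  restrict≤-∘ᵤ f g = begin
    (g ∘ (f ⊗₁ id) ∘ 𝒞ᵥ.splitᵤ) ∘ (id ⊗₁ m)           ≈⟨ pullʳ (pullʳ splitᵤ-natural) ⟩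
    g ∘ (f ⊗₁ id) ∘ ((id ⊗₁ m) ⊗₁ m) ∘ 𝒞ᵤ.splitᵤ      ≈⟨ refl⟩∘⟨ pullˡ slide ⟩
    g ∘ ((id ⊗₁ m) ∘ (R f ⊗₁ id)) ∘ 𝒞ᵤ.splitᵤ         ≈⟨ refl⟩∘⟨ assoc ⟩
    g ∘ (id ⊗₁ m) ∘ (R f ⊗₁ id) ∘ 𝒞ᵤ.splitᵤ           ≈⟨ sym-assoc ⟩
    (g ∘ (id ⊗₁ m)) ∘ (R f ⊗₁ id) ∘ 𝒞ᵤ.splitᵤ         ∎
    where
    open HomReasoning
    slide : (f ⊗₁ id) ∘ ((id ⊗₁ m) ⊗₁ m) ≈ (id ⊗₁ m) ∘ (R f ⊗₁ id)
    slide = ≈.trans (≈.sym ⊗-homomorphism) (≈.trans (⊗-resp-≈ ≈.refl identityˡ) serialize₂₁)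

module LocalisableProperties {o ℓ e} {𝒞 : SymMonCat o ℓ e} {T : Monad 𝒞} (L : Localisable 𝒞 T) where
  open SymMonCat 𝒞
  open MonoidalProperties 𝒞
  open Monad T
  open Localisable L
  open CentralIdem

  private variable
    A B : Obj

  T₁-idᵤ : (c : CentralIdem 𝒞) → Tres.T₁ c (Restrict.idᵤ 𝒞 c {A}) ≈ Restrict.idᵤ 𝒞 c
  T₁-idᵤ {A} c = begin
    F₁ (ρ⇒ ∘ (id ⊗₁ u c)) ∘ st A (U c) (u c)      ≈⟨ F-homomorphism ⟩∘⟨refl ⟩
    (F₁ ρ⇒ ∘ F₁ (id ⊗₁ u c)) ∘ st A (U c) (u c)   ≈⟨ pullʳ (≈.sym (st-m c unit-centralIdem (u c) (≈.sym identityˡ))) ⟩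
    F₁ ρ⇒ ∘ (st A I id ∘ (id ⊗₁ u c))             ≈⟨ pullˡ st-unit ⟩
    ρ⇒ ∘ (id ⊗₁ u c)                              ∎
    where open HomReasoning

  restrict≤-T₁ : (c d : CentralIdem 𝒞) (m : U c ⇒ U d) → u c ≈ u d ∘ m
    → (f : Restrict._⇒ᵤ_ 𝒞 d A B)
    → restrict≤ 𝒞 c d m (Tres.T₁ d f) ≈ Tres.T₁ c (restrict≤ 𝒞 c d m f)
  restrict≤-T₁ {A} c d m u≈v∘m f = begin
    (F₁ f ∘ st A (U d) (u d)) ∘ (id ⊗₁ m)      ≈⟨ pullʳ (st-m c d m u≈v∘m) ⟩
    F₁ f ∘ (F₁ (id ⊗₁ m) ∘ st A (U c) (u c))   ≈⟨ pullˡ (≈.sym F-homomorphism) ⟩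
    F₁ (f ∘ (id ⊗₁ m)) ∘ st A (U c) (u c)      ∎
    where open HomReasoning

lemma3p7 : ∀ {o ℓ e : Level} (𝒞 : SymMonCat o ℓ e) (T : Monad 𝒞) (L : Localisable 𝒞 T)
           (c d : CentralIdem 𝒞) (m : SymMonCat._⇒_ 𝒞 (CentralIdem.U c) (CentralIdem.U d))
           → SymMonCat._≈_ 𝒞 (CentralIdem.u c) (SymMonCat._∘_ 𝒞 (CentralIdem.u d) m)
           → IsRestrictionMonadMorphism 𝒞 T L c d m
lemma3p7 𝒞 T L c d m u≈v∘m =
    restrict≤-idᵤ
  , restrict≤-∘ᵤ
  , (λ f → ≈.trans ∘ᵤ-identityˡ (≈.sym (≈.trans ∘ᵤ-identityʳ (restrict≤-T₁ c d m u≈v∘m f))))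
  , ≈.trans ∘ᵤ-identityˡ (≈.sym restrict≤-ρ∘⊗)
  , ≈.trans (∘ᵤ-resp-≈ (≈.trans ∘ᵤ-identityʳ restrict≤-ρ∘⊗) (T₁-idᵤ c))
            (≈.trans ∘ᵤ-identityʳ (≈.sym ∘ᵤ-identityˡ))
  where
  open MonoidalProperties 𝒞
  open CentralIdemProperties c
  open RestrictionProperties c d m u≈v∘m
  open LocalisableProperties L
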